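{- Let $G$ be a finite group, $\Gamma_G$ its power graph and $M_G$ the set of maximal involutions of $G$. Then $\mathrm{rc}(\Gamma_G)\ge |M_G|$.
   Context: For a finite group $G$ with identity $e$, the power graph $\Gamma_G$ is the undirected graph with vertex set $G$ in which two distinct elements are adjacent if one is a power of the other. An involution is an element of order $2$. An involution $x$ is maximal if the only cyclic subgroup of $G$ containing $x$ is $\langle x\rangle$; $M_G$ denotes the set of maximal involutions of $G$. For a connected graph $\Gamma$, an edge coloring $\zeta:E(\Gamma)\to\{1,\dots,k\}$ (adjacent edges may receive the same color) is a rainbow $k$-coloring if every pair of vertices is joined by a path whose edges have pairwise distinct colors; the rainbow connection number $\mathrm{rc}(\Gamma)$ is the minimum $k$ for which a rainbow $k$-coloring exists. -}

module Defs where

open import Data.Nat using (ℕ; zero; suc; _≤_)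
open import Data.Fin using (Fin)
open import Data.Fin.Subset using (Subset; _∈_; ∣_∣)
open import Data.List using (List; []; _∷_)
open import Data.List.Relation.Unary.Unique.Propositional using (Unique)
open import Data.Product using (Σ; ∃; _×_; _,_)
open import Data.Sum using (_⊎_)
open import Relation.Binary.PropositionalEquality using (_≡_; _≢_)

-- A finite group of order n, with carrier Fin n (every finite group is
-- isomorphic to one of this form).
record FinGroup (n : ℕ) : Set where
  field
    _∙_   : Fin n → Fin n → Fin n
    e     : Fin n
    inv   : Fin n → Fin n
    assoc : ∀ x y z → (x ∙ y) ∙ z ≡ x ∙ (y ∙ z)
    idˡ   : ∀ x → e ∙ x ≡ x
    idʳ   : ∀ x → x ∙ e ≡ x
    invˡ  : ∀ x → inv x ∙ x ≡ e
    invʳ  : ∀ x → x ∙ inv x ≡ e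

module _ {n : ℕ} (G : FinGroup n) where
  open FinGroup G

  pow : Fin n → ℕ → Fin n
  pow x zero    = e
  pow x (suc k) = x ∙ pow x k

  IsPowerOf : Fin n → Fin n → Set
  IsPowerOf y x = ∃ λ k → y ≡ pow x k

  Adj : Fin n → Fin n → Set
  Adj x y = x ≢ y × (IsPowerOf y x ⊎ IsPowerOf x y)

  Involution : Fin n → Set
  Involution x = x ≢ e × x ∙ x ≡ e

  -- maximal involution: the only cyclic subgroup containing x is ⟨x⟩,
  -- i.e. whenever x ∈ ⟨y⟩ we have ⟨y⟩ = ⟨x⟩ (equivalently y ∈ ⟨x⟩).
  MaximalInvolution : Fin n → Set
  MaximalInvolution x =
    Involution x × (∀ y → IsPowerOf x y → IsPowerOf y x)

  data Path : Fin n → Fin n → Set where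
    here : ∀ {x} → Path x x
    step : ∀ {x y z} → Adj x y → Path y z → Path x z

  vertices : ∀ {x y} → Path x y → List (Fin n)
  vertices (here {x})       = x ∷ []
  vertices (step {x} _ p)   = x ∷ vertices p

  -- colours of the edges along a path, for an edge colouring c
  -- (c is symmetric, and only its values on edges matter)
  edgeColours : ∀ {k} → (Fin n → Fin n → Fin k) → ∀ {x y} → Path x y → List (Fin k)
  edgeColours c here               = []
  edgeColours c (step {x} {y} _ p) = c x y ∷ edgeColours c p

  -- a rainbow k-colouring of Γ_G: an edge colouring with colours {1..k}
  -- (here Fin k) such that any two vertices are joined by a path
  -- (distinct vertices) whose edges have pairwise distinct colours.
  RainbowColouring : ℕ → Set
  RainbowColouring k =
    Σ (Fin n → Fin n → Fin k) λ c →
      (∀ x y → c x y ≡ c y x) ×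
      (∀ x y → Σ (Path x y) λ p → Unique (vertices p) × Unique (edgeColours c p))

  -- rc(Γ_G) ≥ m : every rainbow k-colouring has k ≥ m
  RcAtLeast : ℕ → Set
  RcAtLeast m = ∀ k → RainbowColouring k → m ≤ k

module Submission where

-- Let x be a maximal involution.  Its powers are only e and x,
-- and any y with x ∈ ⟨y⟩ already lies in ⟨x⟩; hence e is the unique
-- neighbour of x in the power graph.  Consequently every path ending in a
-- maximal involution y (and starting elsewhere) passes through e, so a path
-- with distinct vertices between two distinct maximal involutions x, y must
-- be exactly x — e — y.  If it is rainbow, the edges xe and ey get different
-- colours.  Thus x ↦ c(e, x) is injective on any set M of maximal
-- involutions, and a counting lemma (an injection from the members of a
-- subset of Fin n into Fin k forces ∣ M ∣ ≤ k) gives ∣ M ∣ ≤ k.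

open import Defs
open import Data.Nat using (ℕ; _≤_; z≤n; s≤s)
open import Data.Fin using (Fin; punchOut) renaming (zero to fzero; suc to fsuc)
open import Data.Fin.Properties using (punchOut-injective; suc-injective; _≟_)
open import Data.Fin.Subset using (Subset; _∈_; ∣_∣; inside; outside)
open import Data.Vec.Base using (_∷_; []; here; there)
open import Data.List using (_∷_)
open import Data.List.Membership.Propositional renaming (_∈_ to _∈L_)
open import Data.List.Relation.Unary.Any using (here; there)
open import Data.List.Relation.Unary.All using (_∷_)
open import Data.List.Relation.Unary.All.Properties using (All¬⇒¬Any)
open import Data.List.Relation.Unary.Unique.Propositional using (Unique)
open import Data.List.Relation.Unary.AllPairs using (_∷_)
open import Data.Product using (∃; _,_)
open import Data.Sum using (_⊎_; inj₁; inj₂; swap)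
open import Data.Empty using (⊥-elim)
open import Relation.Nullary using (yes; no)
open import Relation.Binary.PropositionalEquality
  using (_≡_; _≢_; refl; sym; trans; cong; subst)

injection⇒∣∣≤ : ∀ {n k} (M : Subset n) (f : ∀ i → i ∈ M → Fin k) →
                (∀ i j p q → f i p ≡ f j q → i ≡ j) → ∣ M ∣ ≤ k
injection⇒∣∣≤ [] f f-inj = z≤n
injection⇒∣∣≤ (outside ∷ M) f f-inj =
  injection⇒∣∣≤ M (λ i p → f (fsuc i) (there p))
    (λ i j p q eq → suc-injective (f-inj _ _ _ _ eq))
injection⇒∣∣≤ {k = ℕ.zero} (inside ∷ M) f f-inj with f fzero here
... | ()
injection⇒∣∣≤ {k = ℕ.suc k} (inside ∷ M) f f-inj =
  s≤s (injection⇒∣∣≤ M g g-inj)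
  where
    -- the colour of 0 is never reused, so the others fit in k colours
    f₀-fresh : ∀ i (p : i ∈ M) → f fzero here ≢ f (fsuc i) (there p)
    f₀-fresh i p eq with f-inj _ _ _ _ eq
    ... | ()

    g : ∀ i → i ∈ M → Fin k
    g i p = punchOut (f₀-fresh i p)

    g-inj : ∀ i j p q → g i p ≡ g j q → i ≡ j
    g-inj i j p q eq =
      suc-injective (f-inj _ _ _ _ (punchOut-injective (f₀-fresh i p) (f₀-fresh j q) eq))

first-two-distinct : ∀ {A : Set} {a b : A} {cs} → Unique (a ∷ b ∷ cs) → a ≢ b
first-two-distinct ((a≢b ∷ _) ∷ _) = a≢b

module _ {n : ℕ} (G : FinGroup n) where
  open FinGroup G

  Adj-sym : ∀ {x y} → Adj G x y → Adj G y x
  Adj-sym (x≢y , rel) = (λ y≡x → x≢y (sym y≡x)) , swap rel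

  power-of-involution : ∀ {x w} → x ∙ x ≡ e → IsPowerOf G w x → w ≡ e ⊎ w ≡ x
  power-of-involution {x} xx≡e (k , w≡xᵏ) with powers k
    where
      powers : ∀ k → pow G x k ≡ e ⊎ pow G x k ≡ x
      powers ℕ.zero = inj₁ refl
      powers (ℕ.suc k) with powers k
      ... | inj₁ xᵏ≡e = inj₂ (trans (cong (x ∙_) xᵏ≡e) (idʳ x))
      ... | inj₂ xᵏ≡x = inj₁ (trans (cong (x ∙_) xᵏ≡x) xx≡e)
  ... | inj₁ xᵏ≡e = inj₁ (trans w≡xᵏ xᵏ≡e)
  ... | inj₂ xᵏ≡x = inj₂ (trans w≡xᵏ xᵏ≡x)

  -- The only neighbour of a maximal involution is the identity: a neighbour
  -- lies in ⟨x⟩ (directly, or by maximality when x is a power of it).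
  maximal-neighbour≡e : ∀ {x w} → MaximalInvolution G x → Adj G x w → w ≡ e
  maximal-neighbour≡e {x} {w} ((_ , xx≡e) , maximal) (x≢w , rel)
    with power-of-involution xx≡e (in-⟨x⟩ rel)
    where
      in-⟨x⟩ : IsPowerOf G w x ⊎ IsPowerOf G x w → IsPowerOf G w x
      in-⟨x⟩ (inj₁ w∈⟨x⟩) = w∈⟨x⟩
      in-⟨x⟩ (inj₂ x∈⟨w⟩) = maximal w x∈⟨w⟩
  ... | inj₁ w≡e = w≡e
  ... | inj₂ w≡x = ⊥-elim (x≢w (sym w≡x))

  -- Every path into a maximal involution y from another vertex visits e,
  -- since its last edge ends at a neighbour of y.
  path-into-maximal-visits-e : ∀ {y} → MaximalInvolution G y →
    ∀ {w} (p : Path G w y) → w ≢ y → e ∈L vertices G p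
  path-into-maximal-visits-e my here w≢y = ⊥-elim (w≢y refl)
  path-into-maximal-visits-e {y} my (step {y = u} adj p) w≢y with u ≟ y
  ... | yes refl = here (sym (maximal-neighbour≡e my (Adj-sym adj)))
  ... | no u≢y   = there (path-into-maximal-visits-e my p u≢y)

  -- A path with distinct vertices from e to a maximal involution y starts
  -- with the edge e — y: any other first step would revisit e later.
  simple-path-from-e : ∀ {k} (c : Fin n → Fin n → Fin k) {y} →
    MaximalInvolution G y → (p : Path G e y) → Unique (vertices G p) →
    ∃ λ cs → edgeColours G c p ≡ c e y ∷ cs
  simple-path-from-e c ((y≢e , _) , _) here _ = ⊥-elim (y≢e refl)
  simple-path-from-e c {y} my (step {y = w} _ p) (e∉rest ∷ _) with w ≟ y
  ... | yes refl = edgeColours G c p , refl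
  ... | no w≢y   = ⊥-elim (All¬⇒¬Any e∉rest (path-into-maximal-visits-e my p w≢y))

  -- On a rainbow path with distinct vertices between distinct maximal
  -- involutions x and y (necessarily x — e — y), the two edges differ.
  rainbow-between-maximal : ∀ {k} (c : Fin n → Fin n → Fin k) {x y} →
    MaximalInvolution G x → MaximalInvolution G y → x ≢ y →
    (p : Path G x y) → Unique (vertices G p) → Unique (edgeColours G c p) →
    c x e ≢ c e y
  rainbow-between-maximal c mx my x≢y here _ _ = ⊥-elim (x≢y refl)
  rainbow-between-maximal c {x} mx my x≢y (step adj p) (_ ∷ uv) uc
    with maximal-neighbour≡e mx adj
  ... | refl with simple-path-from-e c my p uv
  ... | cs , colours-p =
    first-two-distinct (subst (λ l → Unique (c x e ∷ l)) colours-p uc)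

lemma2p2 : ∀ {n : ℕ} (G : FinGroup n) →
    ∀ (M : Subset n) → (∀ x → x ∈ M → MaximalInvolution G x) →
    RcAtLeast G ∣ M ∣
lemma2p2 G M maximal k (c , c-sym , rainbow) =
  injection⇒∣∣≤ M (λ i _ → c e i) colour-inj
  where
    open FinGroup G using (e)

    colour-inj : ∀ i j (p : i ∈ M) (q : j ∈ M) → c e i ≡ c e j → i ≡ j
    colour-inj i j p q same with i ≟ j
    ... | yes i≡j = i≡j
    ... | no i≢j with rainbow i j
    ... | path , uv , uc =
      ⊥-elim (rainbow-between-maximal G c (maximal i p) (maximal j q) i≢j
                path uv uc (trans (c-sym i e) same))
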